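{- For every $r$-graph $F$ and integers $n,t$ with $1\le t\le n/v(F)$, $$\mathrm{ar}(n,(t+2)F)\ge\binom nr-\binom{n-t}{r}+\mathrm{ar}(n-t,2F).$$
   Context: An $r$-graph is a collection of $r$-subsets of a finite vertex set; $v(F)$ is its number of vertices; $K_n^r$ is the complete $r$-graph on $n$ vertices; $tF$ denotes $t$ vertex-disjoint copies of $F$. An edge-colored copy of $tF$ is rainbow if all its edges have distinct colors. $\mathrm{ar}(n,tF)$ is the minimum $N$ such that every surjective edge-coloring $K_n^r\to[N]$ contains a rainbow copy of $tF$. -}

module Defs where

open import Data.Nat using (ℕ; zero; suc; _*_; _≤_; _<_)
open import Data.Bool using (Bool; true; false; if_then_else_)
open import Data.Fin using (Fin; zero; suc)
open import Data.Fin.Subset using (Subset; ⁅_⁆; _∪_; ∣_∣) renaming (⊥ to ∅)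
open import Data.Vec using ([]; _∷_)
open import Data.List using (List; map; concatMap; allFin)
open import Data.List.Relation.Unary.All using (All)
open import Data.List.Relation.Unary.Unique.Propositional using (Unique)
open import Data.Product using (Σ; ∃; _×_; _,_)
open import Relation.Binary.PropositionalEquality using (_≡_)

record RGraph (r : ℕ) : Set where
  field
    V        : ℕ
    E        : List (Subset V)
    uniform  : All (λ e → ∣ e ∣ ≡ r) E
    distinct : Unique E
open RGraph public

v : ∀ {r} → RGraph r → ℕ
v F = V F

image : ∀ {m n} → (Fin m → Fin n) → Subset m → Subset n
image {zero}  φ []      = ∅
image {suc m} φ (b ∷ e) =
  (if b then ⁅ φ zero ⁆ else ∅) ∪ image (λ i → φ (suc i)) e

-- An edge-colouring of K_n^r with colours [N]: a colour for every subset of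
-- Fin n (only the values on r-subsets, i.e. edges of K_n^r, matter).
Colouring : ℕ → ℕ → Set
Colouring n N = Subset n → Fin N

Surjective : ∀ {n N} → (r : ℕ) → Colouring n N → Set
Surjective {n} {N} r c = ∀ (k : Fin N) → Σ (Subset n) (λ e → ∣ e ∣ ≡ r × c e ≡ k)

-- A copy of tF in K_n^r: t vertex-disjoint embeddings of the vertex set of F,
-- i.e. a jointly injective map φ : Fin t → Fin (v F) → Fin n.
record Copy {r : ℕ} (n t : ℕ) (F : RGraph r) : Set where
  field
    φ   : Fin t → Fin (V F) → Fin n
    inj : ∀ i j x y → φ i x ≡ φ j y → (i ≡ j × x ≡ y)
open Copy public

copyColours : ∀ {r n t N} {F : RGraph r} → Colouring n N → Copy n t F → List (Fin N)
copyColours {F = F} c K =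
  concatMap (λ i → map (λ e → c (image (φ K i) e)) (E F)) (allFin _)

Rainbow : ∀ {r n t N} {F : RGraph r} → Colouring n N → Copy n t F → Set
Rainbow c K = Unique (copyColours c K)

Forces : (r n t : ℕ) → RGraph r → ℕ → Set
Forces r n t F N =
  ∀ M → N ≤ M → (c : Colouring n M) → Surjective r c →
    Σ (Copy n t F) (λ K → Rainbow c K)

IsAr : (r n t : ℕ) → RGraph r → ℕ → Set
IsAr r n t F a = Forces r n t F a × (∀ N → Forces r n t F N → a ≤ N)

-- Fix a set S of s ≤ t vertices of K_n^r (here the first ones) and let m = n - s. Give each of
-- the C(n,r) - C(m,r) edges meeting S its own colour and colour K_m^r on the remaining vertices
-- by any surjective colouring c' with N - (C(n,r) - C(m,r)) colours. Disjoint copies of F that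
-- meet S meet it in distinct vertices, so a rainbow (t+2)F contains two copies avoiding S: a
-- rainbow 2F for c'. Hence if N colours force a rainbow (t+2)F in K_n^r, then
-- N - (C(n,r) - C(m,r)) colours force a rainbow 2F in K_m^r. That N ≥ C(n,r) - C(m,r) follows
-- from the same colouring with all edges outside S coloured alike, which admits no rainbow 2F
-- outside S.

module Submission where

open import Defs
open import Data.Nat using (ℕ; zero; suc; _+_; _*_; _∸_; _⊓_; _≤_; _<_; s≤s)
open import Data.Nat.Properties
  using (+-assoc; +-comm; +-monoˡ-≤; +-monoʳ-≤; ≤-trans; ≤-reflexive; <⇒≤; ≮⇒≥;
         m≤n+m∸n; m+[n∸m]≡n; m+n∸n≡m; m⊓n≤m; m⊓n+n∸m≡n; module ≤-Reasoning)
open import Data.Nat.Combinatorics using (_C_; nCk+nC[k+1]≡[n+1]C[k+1])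
open import Data.Bool using (if_then_else_)
open import Data.Fin using (Fin; zero; suc; _↑ˡ_; _↑ʳ_; splitAt; fromℕ<)
  renaming (_<_ to _<ᶠ_)
open import Data.Fin.Properties using (splitAt⁻¹-↑ˡ; splitAt⁻¹-↑ʳ; pigeonhole; <⇒≢)
open import Data.Fin.Subset using (Subset; inside; outside; ⁅_⁆; _∪_; ∣_∣)
  renaming (⊥ to ∅)
open import Data.Fin.Subset.Properties using (∣⊥∣≡0)
open import Data.Vec using (_∷_; []; replicate; _++_)
open import Data.List using (List; []; _∷_; map; concat; tabulate)
  renaming (_++_ to _++ˡ_)
open import Data.List.Properties using (map-cong; map-∘; map-++; ++-identityʳ; map-tabulate)
open import Data.List.Relation.Unary.All using (_∷_)
open import Data.List.Relation.Unary.All.Properties using (++⁻ʳ)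
open import Data.List.Relation.Unary.AllPairs using ([]; _∷_)
open import Data.List.Relation.Unary.Unique.Propositional using (Unique)
open import Data.List.Relation.Unary.Unique.Propositional.Properties using (map⁻)
open import Data.List.Relation.Binary.Sublist.Propositional using (_⊆_; []; _∷_; _∷ʳ_; ⊆-refl)
open import Data.List.Relation.Binary.Sublist.Propositional.Properties
  using (All-resp-⊆; ++⁺; ++⁺ˡ; ++⁺ʳ)
open import Data.Maybe as Maybe using (Maybe; just; nothing; maybe′)
open import Data.Sum as Sum using (_⊎_; inj₁; inj₂; [_,_]′)
open import Data.Product as Product using (Σ; ∃; ∃₂; _×_; _,_; proj₁; proj₂)
open import Data.Empty using (⊥-elim)
open import Function using (_∘_; id)
open import Relation.Nullary using (¬_)
open import Relation.Binary.PropositionalEquality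
  using (_≡_; _≢_; _≗_; refl; sym; trans; cong; cong₂; subst; module ≡-Reasoning)

private
  variable
    A : Set
    j k m n r s M K N a b : ℕ
    F : RGraph r

↑ˡ-or-↑ʳ : ∀ m {n} (i : Fin (m + n)) → (∃ λ j → j ↑ˡ n ≡ i) ⊎ (∃ λ j → m ↑ʳ j ≡ i)
↑ˡ-or-↑ʳ m i with splitAt m i in eq
... | inj₁ j = inj₁ (j , splitAt⁻¹-↑ˡ eq)
... | inj₂ j = inj₂ (j , splitAt⁻¹-↑ʳ eq)

Unique-resp-⊆ : {xs ys : List A} → xs ⊆ ys → Unique ys → Unique xs
Unique-resp-⊆ []          []          = []
Unique-resp-⊆ (_ ∷ʳ xs⊆ys) (_ ∷ u)     = Unique-resp-⊆ xs⊆ys u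
Unique-resp-⊆ (refl ∷ xs⊆ys) (x∉ ∷ u) = All-resp-⊆ xs⊆ys x∉ ∷ Unique-resp-⊆ xs⊆ys u

⊆-concat-tabulate : (f : Fin k → List A) (q : Fin k) → f q ⊆ concat (tabulate f)
⊆-concat-tabulate f zero    = ++⁺ʳ _ ⊆-refl
⊆-concat-tabulate f (suc q) = ++⁺ˡ (f zero) (⊆-concat-tabulate (f ∘ suc) q)

++-⊆-concat-tabulate : (f : Fin k → List A) {p q : Fin k} → p <ᶠ q →
                       f p ++ˡ f q ⊆ concat (tabulate f)
++-⊆-concat-tabulate f {zero}  {suc q} _         = ++⁺ ⊆-refl (⊆-concat-tabulate (f ∘ suc) q)
++-⊆-concat-tabulate f {suc p} {suc q} (s≤s p<q) = ++⁺ˡ (f zero) (++-⊆-concat-tabulate (f ∘ suc) p<q)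

_choose_ : ℕ → ℕ → ℕ
n     choose zero  = 1
zero  choose suc k = 0
suc n choose suc k = n choose k + n choose suc k

choose≡C : ∀ n k → n choose k ≡ n C k
choose≡C n       zero    = refl
choose≡C zero    (suc k) = refl
choose≡C (suc n) (suc k) =
  trans (cong₂ _+_ (choose≡C n k) (choose≡C n (suc k))) (nCk+nC[k+1]≡[n+1]C[k+1] n k)

-- The index of an r-subset among all r-subsets; the value on subsets of any other size is junk.
rank : ∀ r → Subset n → Maybe (Fin (n choose r))
rank         zero    _             = just zero
rank         (suc r) []            = nothing
rank {suc n} (suc r) (inside  ∷ e) = Maybe.map (_↑ˡ n choose suc r) (rank r e)
rank {suc n} (suc r) (outside ∷ e) = Maybe.map (n choose r ↑ʳ_) (rank (suc r) e)

rank-onto : ∀ n r (k : Fin (n choose r)) → ∃ λ e → ∣ e ∣ ≡ r × rank r e ≡ just k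
rank-onto n       zero    zero = ∅ , ∣⊥∣≡0 n , refl
rank-onto (suc n) (suc r) k with ↑ˡ-or-↑ʳ (n choose r) k
... | inj₁ (i , refl) = let e , ∣e∣≡r , e↦i = rank-onto n r i in
      inside ∷ e , cong suc ∣e∣≡r , cong (Maybe.map _) e↦i
... | inj₂ (i , refl) = let e , ∣e∣≡r , e↦i = rank-onto n (suc r) i in
      outside ∷ e , ∣e∣≡r , cong (Maybe.map _) e↦i

-- The number C(s + m, r) - C(m, r) of r-subsets of Fin (s + m) meeting the first s vertices.
meeting : ℕ → ℕ → ℕ → ℕ
meeting m zero    s       = 0
meeting m (suc r) zero    = 0
meeting m (suc r) (suc s) = (s + m) choose r + meeting m (suc r) s

meeting+choose≡choose : ∀ m r s → meeting m r s + m choose r ≡ (s + m) choose r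
meeting+choose≡choose m zero    s       = refl
meeting+choose≡choose m (suc r) zero    = refl
meeting+choose≡choose m (suc r) (suc s) =
  trans (+-assoc ((s + m) choose r) _ _)
        (cong ((s + m) choose r +_) (meeting+choose≡choose m (suc r) s))

[s+m]Cr∸mCr≡meeting : ∀ m r s → (s + m) C r ∸ m C r ≡ meeting m r s
[s+m]Cr∸mCr≡meeting m r s = begin
  (s + m) C r ∸ m C r                      ≡⟨ cong₂ _∸_ (choose≡C (s + m) r) (choose≡C m r) ⟨
  (s + m) choose r ∸ m choose r            ≡⟨ cong (_∸ m choose r) (meeting+choose≡choose m r s) ⟨
  meeting m r s + m choose r ∸ m choose r  ≡⟨ m+n∸n≡m (meeting m r s) (m choose r) ⟩
  meeting m r s                            ∎
  where open ≡-Reasoning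

pad : ∀ s → Subset m → Subset (s + m)
pad s w = replicate s outside ++ w

∣pad∣ : ∀ s (w : Subset m) → ∣ pad s w ∣ ≡ ∣ w ∣
∣pad∣ zero    w = refl
∣pad∣ (suc s) w = ∣pad∣ s w

-- Ranks the r-sets meeting the first s vertices (inj₁) and recovers w from pad s w (inj₂);
-- other sets get junk values.
classify : ∀ r s → Subset (s + m) → Fin (meeting m r s) ⊎ Subset m
classify         r       zero    e             = inj₂ e
classify         zero    (suc s) (_ ∷ e)       = classify zero s e
classify {m = m} (suc r) (suc s) (inside  ∷ e) =
  maybe′ (inj₁ ∘ (_↑ˡ meeting m (suc r) s))
         (Sum.map₁ ((s + m) choose r ↑ʳ_) (classify (suc r) s e))
         (rank r e)
classify {m = m} (suc r) (suc s) (outside ∷ e) =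
  Sum.map₁ ((s + m) choose r ↑ʳ_) (classify (suc r) s e)

classify-pad : ∀ r s (w : Subset m) → classify r s (pad s w) ≡ inj₂ w
classify-pad r       zero    w = refl
classify-pad zero    (suc s) w = classify-pad zero s w
classify-pad (suc r) (suc s) w = cong (Sum.map₁ _) (classify-pad (suc r) s w)

classify-onto : ∀ r s (k : Fin (meeting m r s)) → ∃ λ e → ∣ e ∣ ≡ r × classify r s e ≡ inj₁ k
classify-onto {m} (suc r) (suc s) k with ↑ˡ-or-↑ʳ ((s + m) choose r) k
... | inj₁ (i , refl) = let e , ∣e∣≡r , e↦i = rank-onto (s + m) r i in
      inside ∷ e , cong suc ∣e∣≡r , cong (maybe′ _ _) e↦i
... | inj₂ (i , refl) = let e , ∣e∣≡r+1 , e↦i = classify-onto (suc r) s i in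
      outside ∷ e , ∣e∣≡r+1 , cong (Sum.map₁ _) e↦i

image-cong : {f g : Fin k → Fin n} → f ≗ g → ∀ e → image f e ≡ image g e
image-cong {zero}  f≗g []      = refl
image-cong {suc k} f≗g (x ∷ e) =
  cong₂ (λ i → (if x then ⁅ i ⁆ else ∅) ∪_) (f≗g zero) (image-cong (f≗g ∘ suc) e)

image-suc : (f : Fin k → Fin n) (e : Subset k) → image (suc ∘ f) e ≡ outside ∷ image f e
image-suc f []            = refl
image-suc f (inside  ∷ e) = cong (⁅ suc (f zero) ⁆ ∪_) (image-suc (f ∘ suc) e)
image-suc f (outside ∷ e) = cong (∅ ∪_) (image-suc (f ∘ suc) e)

image-↑ʳ : ∀ s (f : Fin k → Fin m) e → image ((s ↑ʳ_) ∘ f) e ≡ pad s (image f e)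
image-↑ʳ zero    f e = refl
image-↑ʳ (suc s) f e = trans (image-suc ((s ↑ʳ_) ∘ f) e) (cong (outside ∷_) (image-↑ʳ s f e))

edgeColours : (F : RGraph r) → Colouring n M → (Fin (V F) → Fin n) → List (Fin M)
edgeColours F c f = map (λ e → c (image f e)) (E F)

Avoids : ∀ s → (Fin k → Fin (s + m)) → Set
Avoids {k} {m} s f = Σ (Fin k → Fin m) λ f' → f ≗ (s ↑ʳ_) ∘ f'

Hits : ∀ s → (Fin k → Fin (s + m)) → Set
Hits {m = m} s f = ∃₂ λ x i → f x ≡ i ↑ˡ m

hits-or-avoids : ∀ s (f : Fin k → Fin (s + m)) → Hits s f ⊎ Avoids s f
hits-or-avoids {zero}  s f = inj₂ ((λ ()) , (λ ()))
hits-or-avoids {suc k} s f with ↑ˡ-or-↑ʳ s (f zero) | hits-or-avoids s (f ∘ suc)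
... | inj₁ (i , i↦) | _                  = inj₁ (zero , i , sym i↦)
... | inj₂ _        | inj₁ (x , i , fx≡) = inj₁ (suc x , i , fx≡)
... | inj₂ (j , j↦) | inj₂ (f' , f≗)     =
  inj₂ ((λ { zero → j ; (suc x) → f' x }) , (λ { zero → sym j↦ ; (suc x) → f≗ x }))

hitVertex : {f : Fin k → Fin (s + m)} → Hits s f ⊎ Avoids s f → Fin (suc s)
hitVertex (inj₁ (_ , i , _)) = suc i
hitVertex (inj₂ _)           = zero

-- Disjoint copies hitting the first s vertices hit distinct ones, so among more than
-- s + 1 copies the pigeonhole principle finds two that avoid them.
avoiding-pair : suc s < k → (Q : Copy (s + m) k F) →
                ∃₂ λ p q → p <ᶠ q × Avoids s (φ Q p) × Avoids s (φ Q q)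
avoiding-pair {s} s<k Q with pigeonhole s<k (hitVertex ∘ hits-or-avoids s ∘ φ Q)
... | p , q , p<q , same =
  p , q , p<q , both-avoid (<⇒≢ p<q) (hits-or-avoids s (φ Q p)) (hits-or-avoids s (φ Q q)) same
  where
  both-avoid : ∀ {p q} → p ≢ q →
               (hp : Hits s (φ Q p) ⊎ Avoids s (φ Q p)) (hq : Hits s (φ Q q) ⊎ Avoids s (φ Q q)) →
               hitVertex hp ≡ hitVertex hq → Avoids s (φ Q p) × Avoids s (φ Q q)
  both-avoid _   (inj₂ ap)            (inj₂ aq)            _    = ap , aq
  both-avoid p≢q (inj₁ (x , i , px≡)) (inj₁ (y , _ , qy≡)) refl =
    ⊥-elim (p≢q (proj₁ (inj Q _ _ x y (trans px≡ (sym qy≡)))))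

restrict : (Q : Copy (s + m) k F) (σ : Fin j → Fin k) → (∀ {a b} → σ a ≡ σ b → a ≡ b) →
           (∀ a → Avoids s (φ Q (σ a))) → Copy m j F
restrict {s} Q σ σ-inj avoid = record
  { φ   = λ a → proj₁ (avoid a)
  ; inj = λ a b x y eq → Product.map₁ σ-inj (inj Q (σ a) (σ b) x y
            (trans (proj₂ (avoid a) x) (trans (cong (s ↑ʳ_) eq) (sym (proj₂ (avoid b) y)))))
  }

edgeColours-avoiding : (F : RGraph r) (c : Colouring (s + m) M) (c' : Colouring m K) (g : Fin K → Fin M) →
                       (∀ w → c (pad s w) ≡ g (c' w)) →
                       {f : Fin (V F) → Fin (s + m)} (f' : Fin (V F) → Fin m) → f ≗ (s ↑ʳ_) ∘ f' →
                       edgeColours F c f ≡ map g (edgeColours F c' f')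
edgeColours-avoiding {s = s} F c c' g c-pad {f} f' f≗ = begin
  map (λ e → c (image f e)) (E F)            ≡⟨ map-cong colour-edge (E F) ⟩
  map (g ∘ λ e → c' (image f' e)) (E F)      ≡⟨ map-∘ (E F) ⟩
  map g (map (λ e → c' (image f' e)) (E F))  ∎
  where
  open ≡-Reasoning
  colour-edge : ∀ e → c (image f e) ≡ g (c' (image f' e))
  colour-edge e = trans (cong c (trans (image-cong f≗ e) (image-↑ʳ s f' e))) (c-pad (image f' e))

rainbow-avoiding-pair : (c : Colouring (s + m) M) (c' : Colouring m K) (g : Fin K → Fin M) →
                        (∀ w → c (pad s w) ≡ g (c' w)) → suc s < k →
                        (Q : Copy (s + m) k F) → Rainbow c Q → Σ (Copy m 2 F) (Rainbow c')
rainbow-avoiding-pair {F = F} c c' g c-pad s<k Q rainbow with avoiding-pair s<k Q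
... | p , q , p<q , (f , f≗) , (f' , f'≗) = restrict Q pair pair-injective avoid , rainbow′
  where
  pair : Fin 2 → Fin _
  pair zero       = p
  pair (suc zero) = q

  pair-injective : ∀ {a b} → pair a ≡ pair b → a ≡ b
  pair-injective {zero}     {zero}     _  = refl
  pair-injective {zero}     {suc zero} eq = ⊥-elim (<⇒≢ p<q eq)
  pair-injective {suc zero} {zero}     eq = ⊥-elim (<⇒≢ p<q (sym eq))
  pair-injective {suc zero} {suc zero} _  = refl

  avoid : ∀ a → Avoids _ (φ Q (pair a))
  avoid zero       = f , f≗
  avoid (suc zero) = f' , f'≗

  unique-p++q : Unique (edgeColours F c (φ Q p) ++ˡ edgeColours F c (φ Q q))
  unique-p++q = Unique-resp-⊆ (++-⊆-concat-tabulate (edgeColours F c ∘ φ Q) p<q)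
                  (subst Unique (cong concat (map-tabulate id (edgeColours F c ∘ φ Q))) rainbow)

  unique-map : Unique (map g (edgeColours F c' f ++ˡ edgeColours F c' f'))
  unique-map = subst Unique
    (trans (cong₂ _++ˡ_ (edgeColours-avoiding F c c' g c-pad f f≗)
                        (edgeColours-avoiding F c c' g c-pad f' f'≗))
           (sym (map-++ g (edgeColours F c' f) (edgeColours F c' f'))))
    unique-p++q

  rainbow′ : Unique (edgeColours F c' f ++ˡ (edgeColours F c' f' ++ˡ []))
  rainbow′ = subst Unique (cong (edgeColours F c' f ++ˡ_) (sym (++-identityʳ (edgeColours F c' f'))))
                 (map⁻ unique-map)

constant-not-rainbow : E F ≢ [] → (x : Fin M) (K : Copy m 2 F) → ¬ Rainbow (λ _ → x) K
constant-not-rainbow {F = F} E≢[] x K = repeated (E F) E≢[]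
  where
  repeated : (es : List A) → es ≢ [] → ¬ Unique (map (λ _ → x) es ++ˡ (map (λ _ → x) es ++ˡ []))
  repeated []       es≢[] _        = es≢[] refl
  repeated (_ ∷ es) _     (x∉ ∷ _) with ++⁻ʳ (map (λ _ → x) es) x∉
  ... | x≢x ∷ _ = x≢x refl

forces-restrict : suc s < k → Forces r (s + m) k F N → Forces r m 2 F (N ∸ meeting m r s)
forces-restrict {s = s} {r = r} {m = m} {N = N} s<k forces M' N∸D≤M' c' c'-onto =
  let Q , rainbow = forces (D + M') N≤D+M' c c-onto in
  rainbow-avoiding-pair c c' (D ↑ʳ_) c-pad s<k Q rainbow
  where
  D : ℕ
  D = meeting m r s

  c : Colouring (s + m) (D + M')
  c = [ _↑ˡ M' , (D ↑ʳ_) ∘ c' ]′ ∘ classify r s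

  c-pad : ∀ w → c (pad s w) ≡ D ↑ʳ c' w
  c-pad w = cong [ _ , _ ]′ (classify-pad r s w)

  N≤D+M' : N ≤ D + M'
  N≤D+M' = ≤-trans (m≤n+m∸n N D) (+-monoʳ-≤ D N∸D≤M')

  c-onto : Surjective r c
  c-onto k with ↑ˡ-or-↑ʳ D k
  ... | inj₁ (i , refl) = let e , ∣e∣≡r , e↦i = classify-onto r s i in
        e , ∣e∣≡r , cong [ _ , _ ]′ e↦i
  ... | inj₂ (j , refl) = let w , ∣w∣≡r , w↦j = c'-onto j in
        pad s w , trans (∣pad∣ s w) ∣w∣≡r , trans (c-pad w) (cong (D ↑ʳ_) w↦j)

-- Colour all edges avoiding the first s vertices with one colour that also appears on an edge
-- meeting them: no rainbow 2F can avoid those vertices.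
forces⇒meeting≤ : E F ≢ [] → suc s < k → Forces r (s + m) k F N → meeting m r s ≤ N
forces⇒meeting≤ {r = r} {s = s} {m = m} {N = N} E≢[] s<k forces = ≮⇒≥ too-few
  where
  too-few : ¬ N < meeting m r s
  too-few N<D =
    let Q , rainbow  = forces _ (<⇒≤ N<D) c c-onto
        K , rainbow′ = rainbow-avoiding-pair c (λ _ → d) id c-pad s<k Q rainbow
    in constant-not-rainbow E≢[] d K rainbow′
    where
    d : Fin (meeting m r s)
    d = fromℕ< N<D

    c : Colouring (s + m) (meeting m r s)
    c = [ id , (λ _ → d) ]′ ∘ classify r s

    c-pad : ∀ w → c (pad s w) ≡ d
    c-pad w = cong [ _ , _ ]′ (classify-pad r s w)

    c-onto : Surjective r c
    c-onto i = let e , ∣e∣≡r , e↦i = classify-onto r s i in e , ∣e∣≡r , cong [ _ , _ ]′ e↦i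

ar-lower-bound : E F ≢ [] → suc s < k → Forces r (s + m) k F a →
                 (∀ N → Forces r m 2 F N → b ≤ N) → meeting m r s + b ≤ a
ar-lower-bound {r = r} {s = s} {m = m} {a = a} {b = b} E≢[] s<k forces-a minimal-b = begin
  meeting m r s + b                    ≤⟨ +-monoʳ-≤ (meeting m r s) (minimal-b _ (forces-restrict s<k forces-a)) ⟩
  meeting m r s + (a ∸ meeting m r s)  ≡⟨ m+[n∸m]≡n (forces⇒meeting≤ E≢[] s<k forces-a) ⟩
  a                                    ∎
  where open ≤-Reasoning

-- Only s = min t n ≤ t vertices are set aside.
fact3p1 : (r : ℕ) (F : RGraph r) → E F ≢ [] → (n t : ℕ) → 1 ≤ t → t * v F ≤ n →
    (a b : ℕ) → IsAr r n (t + 2) F a → IsAr r (n ∸ t) 2 F b →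
    (n C r) ∸ ((n ∸ t) C r) + b ≤ a
fact3p1 r F E≢[] n t _ _ a b (forces-a , _) (_ , minimal-b) = begin
  n C r ∸ (n ∸ t) C r + b                    ≡⟨ cong (λ n′ → n′ C r ∸ (n ∸ t) C r + b) t⊓n+[n∸t]≡n ⟨
  (t ⊓ n + (n ∸ t)) C r ∸ (n ∸ t) C r + b    ≡⟨ cong (_+ b) ([s+m]Cr∸mCr≡meeting (n ∸ t) r (t ⊓ n)) ⟩
  meeting (n ∸ t) r (t ⊓ n) + b              ≤⟨ ar-lower-bound E≢[] t⊓n<t+2 forces-a′ minimal-b ⟩
  a                                          ∎
  where
  open ≤-Reasoning
  t⊓n+[n∸t]≡n : t ⊓ n + (n ∸ t) ≡ n
  t⊓n+[n∸t]≡n = m⊓n+n∸m≡n t n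
  t⊓n<t+2 : suc (t ⊓ n) < t + 2
  t⊓n<t+2 = ≤-trans (≤-reflexive (+-comm 2 (t ⊓ n))) (+-monoˡ-≤ 2 (m⊓n≤m t n))
  forces-a′ : Forces r (t ⊓ n + (n ∸ t)) (t + 2) F a
  forces-a′ = subst (λ n′ → Forces r n′ (t + 2) F a) (sym t⊓n+[n∸t]≡n) forces-a
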